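{- Let $N$ be a level-1 network on $X$ and let $Y\subseteq X$ with $|Y|\geq 2$. Then there exists a unique interior vertex $v_Y$ of $N$ such that $Y\subseteq \mathcal F(v_Y)$ but $Y\not\subseteq \mathcal F(v')$ for every child $v'$ of $v_Y$. Furthermore, there exist two distinct elements $x,y\in Y$ such that $v_Y=v_{\{x,y\}}$.
   Context: $X$ is a finite set with $|X|\geq 3$. All directed graphs have no loops or multiple edges. A rooted DAG is a directed acyclic graph with a unique vertex of indegree $0$ (its root). A leaf is a vertex of indegree $1$ and outdegree $0$; an interior vertex is a vertex that is not a leaf. A hybrid vertex is a vertex of indegree $2$ and nonzero outdegree. A cycle of a DAG $G$ is an induced subgraph of $G$ whose underlying undirected graph is a cycle. A (rooted) phylogenetic network on $X$ is a rooted DAG with no vertex of indegree $1$ and outdegree $1$ whose set of leaves is $X$; it is a level-1 network if each of its interior vertices belongs to at most one cycle. For a vertex $v$, $\mathcal F(v)$ denotes the set of leaves $w$ for which there is a directed path from $v$ to $w$. -}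

module Defs where

open import Data.Nat using (ℕ; _≤_)
open import Data.Fin using (Fin)
open import Data.Fin.Subset using (Subset; _∈_; ∣_∣; _∩_)
open import Data.Vec using (tabulate)
open import Data.Bool using (Bool; true; _∨_)
open import Data.Product using (_×_; ∃; Σ)
open import Data.Sum using (_⊎_)
open import Relation.Binary.PropositionalEquality using (_≡_)
open import Relation.Nullary using (¬_)

-- A directed graph on vertex set Fin n, given by its (Boolean) adjacency
-- relation; a relation automatically excludes multiple edges.
Graph : ℕ → Set
Graph n = Fin n → Fin n → Bool

module _ {n : ℕ} (G : Graph n) where

  Edge : Fin n → Fin n → Set
  Edge u v = G u v ≡ true

  NoLoops : Set
  NoLoops = ∀ v → ¬ Edge v v

  inNbrs : Fin n → Subset n
  inNbrs v = tabulate (λ u → G u v)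

  outNbrs : Fin n → Subset n
  outNbrs v = tabulate (λ w → G v w)

  indeg : Fin n → ℕ
  indeg v = ∣ inNbrs v ∣

  outdeg : Fin n → ℕ
  outdeg v = ∣ outNbrs v ∣

  data Path : Fin n → Fin n → Set where
    here : ∀ {v} → Path v v
    step : ∀ {u v w} → Edge u v → Path v w → Path u w

  Acyclic : Set
  Acyclic = ∀ {u v} → Edge u v → ¬ Path v u

  Rooted : Set
  Rooted = ∃ λ r → indeg r ≡ 0 × (∀ v → indeg v ≡ 0 → v ≡ r)

  IsLeaf : Fin n → Set
  IsLeaf v = indeg v ≡ 1 × outdeg v ≡ 0

  Interior : Fin n → Set
  Interior v = ¬ IsLeaf v

  -- w ∈ 𝓕(v): w is a leaf reachable from v by a directed path
  InF : Fin n → Fin n → Set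
  InF v w = IsLeaf w × Path v w

  _⊆F_ : Subset n → Fin n → Set
  Y ⊆F v = ∀ w → w ∈ Y → InF v w

  uadj : Fin n → Fin n → Bool
  uadj u v = G u v ∨ G v u

  UAdj : Fin n → Fin n → Set
  UAdj u v = uadj u v ≡ true

  nbrsIn : Subset n → Fin n → Subset n
  nbrsIn C v = tabulate (λ u → uadj u v) ∩ C

  data UPathIn (C : Subset n) : Fin n → Fin n → Set where
    here : ∀ {v} → v ∈ C → UPathIn C v v
    step : ∀ {u v w} → u ∈ C → UAdj u v → UPathIn C v w → UPathIn C u w

  -- C induces a cycle: the induced underlying undirected graph on C is a
  -- cycle, i.e. at least 3 vertices, 2-regular and connected.
  IsCycle : Subset n → Set
  IsCycle C = 3 ≤ ∣ C ∣
            × (∀ v → v ∈ C → ∣ nbrsIn C v ∣ ≡ 2)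
            × (∀ u w → u ∈ C → w ∈ C → UPathIn C u w)

  -- phylogenetic network on its leaf set X, with |X| ≥ 3
  IsPhyloNetwork : Set
  IsPhyloNetwork =
      NoLoops
    × Acyclic
    × Rooted
    × (∀ v → ¬ (indeg v ≡ 1 × outdeg v ≡ 1))
    × (Σ (Fin n) λ a → Σ (Fin n) λ b → Σ (Fin n) λ c →
         IsLeaf a × IsLeaf b × IsLeaf c × ¬ a ≡ b × ¬ a ≡ c × ¬ b ≡ c)

  IsLevel1 : Set
  IsLevel1 = ∀ v → Interior v → ∀ C₁ C₂ → IsCycle C₁ → IsCycle C₂
           → v ∈ C₁ → v ∈ C₂ → C₁ ≡ C₂

  IsLevel1Network : Set
  IsLevel1Network = IsPhyloNetwork × IsLevel1

  IsVY : Subset n → Fin n → Set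
  IsVY Y v = Interior v × Y ⊆F v × (∀ v' → Edge v v' → ¬ (Y ⊆F v'))

module Submission where

-- Existence: every leaf is reachable from the root, so starting from the root
-- and stepping to a child whose descendant leaves still contain Y we reach a
-- vertex v_Y none of whose children does (the descent terminates by
-- well-foundedness of reachability in a finite acyclic graph).
--
-- Uniqueness and the pair property rest on one structural fact about level-1
-- graphs: an interior vertex v has at most two neighbours u such that the
-- edge u–v lies on a cycle, i.e. some undirected walk returns from u to v
-- without using u–v.  Such a walk is shortened to a chordless one, whose
-- vertex set induces a cycle (IsCycle) through u and v; three
-- such cycles at v coincide by the level-1 condition, so v would have three
-- neighbours on one cycle.  If v_Y were not unique, two incomparable
-- candidates give three such neighbours of one of them (two children and a
-- parent); if no pair x, y ∈ Y had v_{x,y} = v_Y, three children of v_Y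
-- pairwise sharing descendant leaves would do the same.

open import Defs
open import Data.Bool using (Bool; true; _∨_)
import Data.Bool.Properties as Bool
open import Data.Empty using (⊥; ⊥-elim)
open import Data.Fin using (Fin)
open import Data.Fin.Induction using (spo-wellFounded; spo-noetherian)
open import Data.Fin.Properties using (_≟_; any?; all?)
open import Data.Fin.Subset
  using (Subset; _∈_; ∣_∣; _∪_; ⁅_⁆; _⊆_; _-_; Nonempty; inside; outside)
  renaming (⊥ to ∅)
open import Data.Fin.Subset.Properties
  using ( x∈⁅x⁆; x∈⁅y⁆⇒x≡y; x∈p∪q⁺; x∈p∪q⁻; ∉⊥; x∈p∩q⁺; x∈p∩q⁻; ∣⁅x⁆∣≡1; ∣⊥∣≡0
        ; p⊆q⇒∣p∣≤∣q∣; x∈p⇒∣p-x∣<∣p∣; x∈p∧x≢y⇒x∈p-y; nonempty?; Empty-unique; _∈?_)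
open import Data.List using (List; _∷_; [])
open import Data.List.Membership.Propositional using () renaming (_∈_ to _∈ₗ_; _∉_ to _∉ₗ_)
open import Data.List.Relation.Unary.All as All using (All; _∷_; [])
open import Data.List.Relation.Unary.Any using (here; there)
open import Data.Nat using (ℕ; suc; _+_; _≤_; z≤n; s≤s)
import Data.Nat.Properties as ℕₚ
open import Data.Nat.Properties
  using (≤-trans; ≤-antisym; ≤-reflexive; +-monoʳ-≤; +-suc; n≤1+n; n≢0⇒n>0; module ≤-Reasoning)
open import Data.Product using (_×_; _,_; Σ; ∃; ∃₂; proj₁; proj₂)
open import Data.Sum using (_⊎_; inj₁; inj₂)
open import Data.Unit using (tt) renaming (⊤ to Unit)
open import Data.Vec using (_∷_; []; tabulate)
open import Data.Vec.Properties using ([]=⇒lookup; lookup⇒[]=; lookup∘tabulate)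
open import Function using (_∘_; id; flip; case_of_)
open import Induction.WellFounded using (Acc; acc)
open import Relation.Binary.Structures using (IsStrictPartialOrder)
open import Relation.Binary.Construct.Closure.ReflexiveTransitive
  using (Star; ε; _◅_; _◅◅_; reverse; return) renaming (map to mapStar)
open import Relation.Binary.PropositionalEquality
  using (_≡_; _≢_; refl; sym; trans; cong; cong₂; subst; resp₂; isEquivalence)
open import Relation.Nullary using (¬_; Dec; yes; no)
open import Relation.Nullary.Decidable using (_×-dec_; _⊎-dec_; _→-dec_; ¬?; map′)

private
  variable
    n : ℕ

-- Counting in finite subsets

∈-tabulate⁺ : ∀ {f : Fin n → Bool} {x} → f x ≡ true → x ∈ tabulate f
∈-tabulate⁺ {f = f} {x} fx = lookup⇒[]= x (tabulate f) (trans (lookup∘tabulate f x) fx)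

∈-tabulate⁻ : ∀ {f : Fin n → Bool} {x} → x ∈ tabulate f → f x ≡ true
∈-tabulate⁻ {f = f} {x} x∈ = trans (sym (lookup∘tabulate f x)) ([]=⇒lookup x∈)

∣p∪q∣≤∣p∣+∣q∣ : (p q : Subset n) → ∣ p ∪ q ∣ ≤ ∣ p ∣ + ∣ q ∣
∣p∪q∣≤∣p∣+∣q∣ []            []            = z≤n
∣p∪q∣≤∣p∣+∣q∣ (inside  ∷ p) (inside  ∷ q) =
  s≤s (≤-trans (∣p∪q∣≤∣p∣+∣q∣ p q) (+-monoʳ-≤ ∣ p ∣ (n≤1+n ∣ q ∣)))
∣p∪q∣≤∣p∣+∣q∣ (inside  ∷ p) (outside ∷ q) = s≤s (∣p∪q∣≤∣p∣+∣q∣ p q)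
∣p∪q∣≤∣p∣+∣q∣ (outside ∷ p) (inside  ∷ q) =
  ≤-trans (s≤s (∣p∪q∣≤∣p∣+∣q∣ p q)) (≤-reflexive (sym (+-suc ∣ p ∣ ∣ q ∣)))
∣p∪q∣≤∣p∣+∣q∣ (outside ∷ p) (outside ∷ q) = ∣p∪q∣≤∣p∣+∣q∣ p q

≤∣p-x∣⇒<∣p∣ : ∀ {S : Subset n} {x k} → x ∈ S → k ≤ ∣ S - x ∣ → suc k ≤ ∣ S ∣
≤∣p-x∣⇒<∣p∣ x∈S k≤ = ≤-trans (s≤s k≤) (x∈p⇒∣p-x∣<∣p∣ x∈S)

2≤∣p∣ : ∀ {S : Subset n} {a b} → a ≢ b → a ∈ S → b ∈ S → 2 ≤ ∣ S ∣
2≤∣p∣ a≢b a∈S b∈S = ≤∣p-x∣⇒<∣p∣ a∈S (≤∣p-x∣⇒<∣p∣ (x∈p∧x≢y⇒x∈p-y b∈S (a≢b ∘ sym)) z≤n)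

3≤∣p∣ : ∀ {S : Subset n} {a b c} → a ≢ b → a ≢ c → b ≢ c → a ∈ S → b ∈ S → c ∈ S → 3 ≤ ∣ S ∣
3≤∣p∣ a≢b a≢c b≢c a∈S b∈S c∈S =
  ≤∣p-x∣⇒<∣p∣ a∈S (2≤∣p∣ b≢c (x∈p∧x≢y⇒x∈p-y b∈S (a≢b ∘ sym)) (x∈p∧x≢y⇒x∈p-y c∈S (a≢c ∘ sym)))

∣p∣≡2 : ∀ {S : Subset n} {a b} → a ≢ b → a ∈ S → b ∈ S
      → (∀ z → z ∈ S → z ≡ a ⊎ z ≡ b) → ∣ S ∣ ≡ 2
∣p∣≡2 {S = S} {a} {b} a≢b a∈S b∈S only = ≤-antisym atMost2 (2≤∣p∣ a≢b a∈S b∈S)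
  where
  S⊆ab : S ⊆ ⁅ a ⁆ ∪ ⁅ b ⁆
  S⊆ab {z} z∈S with only z z∈S
  ... | inj₁ refl = x∈p∪q⁺ (inj₁ (x∈⁅x⁆ a))
  ... | inj₂ refl = x∈p∪q⁺ (inj₂ (x∈⁅x⁆ b))

  open ≤-Reasoning
  atMost2 : ∣ S ∣ ≤ 2
  atMost2 = begin
    ∣ S ∣                 ≤⟨ p⊆q⇒∣p∣≤∣q∣ S⊆ab ⟩
    ∣ ⁅ a ⁆ ∪ ⁅ b ⁆ ∣     ≤⟨ ∣p∪q∣≤∣p∣+∣q∣ ⁅ a ⁆ ⁅ b ⁆ ⟩
    ∣ ⁅ a ⁆ ∣ + ∣ ⁅ b ⁆ ∣ ≡⟨ cong₂ _+_ (∣⁅x⁆∣≡1 a) (∣⁅x⁆∣≡1 b) ⟩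
    2                     ∎

∣p∣≤1 : ∀ {S : Subset n} x → (∀ z → z ∈ S → z ≡ x) → ∣ S ∣ ≤ 1
∣p∣≤1 {S = S} x only = ≤-trans (p⊆q⇒∣p∣≤∣q∣ S⊆x) (≤-reflexive (∣⁅x⁆∣≡1 x))
  where
  S⊆x : S ⊆ ⁅ x ⁆
  S⊆x {z} z∈S with only z z∈S
  ... | refl = x∈⁅x⁆ x

nonempty : ∀ {n} {S : Subset n} → 1 ≤ ∣ S ∣ → Nonempty S
nonempty {n} {S} 1≤∣S∣ with nonempty? S
... | yes S≠∅ = S≠∅
... | no  S=∅ = case subst (1 ≤_) (trans (cong ∣_∣ (Empty-unique S=∅)) (∣⊥∣≡0 n)) 1≤∣S∣ of λ ()

listSet : List (Fin n) → Subset n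
listSet []       = ∅
listSet (x ∷ xs) = ⁅ x ⁆ ∪ listSet xs

∈listSet⁺ : ∀ {x} (xs : List (Fin n)) → x ∈ₗ xs → x ∈ listSet xs
∈listSet⁺ (y ∷ _)  (here refl) = x∈p∪q⁺ (inj₁ (x∈⁅x⁆ y))
∈listSet⁺ (_ ∷ xs) (there x∈)  = x∈p∪q⁺ (inj₂ (∈listSet⁺ xs x∈))

∈listSet⁻ : ∀ {x} (xs : List (Fin n)) → x ∈ listSet xs → x ∈ₗ xs
∈listSet⁻ []       x∈ = ⊥-elim (∉⊥ x∈)
∈listSet⁻ (y ∷ xs) x∈ with x∈p∪q⁻ ⁅ y ⁆ (listSet xs) x∈
... | inj₁ x∈y  = here (x∈⁅y⁆⇒x≡y y x∈y)
... | inj₂ x∈xs = there (∈listSet⁻ xs x∈xs)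

-- Directed paths in acyclic graphs

module DirectedPaths {n} (G : Graph n) where

  _++ᵖ_ : ∀ {u v w} → Path G u v → Path G v w → Path G u w
  here     ++ᵖ q = q
  step e p ++ᵖ q = step e (p ++ᵖ q)

  _▸_ : ∀ {u v w} → Path G u v → Edge G v w → Path G u w
  p ▸ e = p ++ᵖ step e here

  firstEdge : ∀ {u v} → Path G u v → u ≢ v → ∃ λ c → Edge G u c × Path G c v
  firstEdge here       u≢v = ⊥-elim (u≢v refl)
  firstEdge (step e p) _   = _ , e , p

  leaf-path : ∀ {v w} → IsLeaf G v → Path G v w → w ≡ v
  leaf-path _               here       = refl
  leaf-path {v} (_ , outdeg≡0) (step e _) =
    case subst (1 ≤_) outdeg≡0 (≤∣p-x∣⇒<∣p∣ {S = outNbrs G v} (∈-tabulate⁺ e) z≤n) of λ ()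

  Edge? : ∀ u v → Dec (Edge G u v)
  Edge? u v = G u v Bool.≟ true

  leaf? : ∀ v → Dec (IsLeaf G v)
  leaf? v = (indeg G v ℕₚ.≟ 1) ×-dec (outdeg G v ℕₚ.≟ 0)

module AcyclicGraph {n} (G : Graph n) (acyclic : Acyclic G) where

  open DirectedPaths G public

  noLoops : NoLoops G
  noLoops v e = acyclic e here

  -- Strict reachability u ↝⁺ v (by a path with at least one edge) is a strict
  -- partial order on a finite set, hence well-founded in both directions.
  _↝⁺_ : Fin n → Fin n → Set
  u ↝⁺ v = ∃ λ w → Edge G u w × Path G w v

  ↝⁺-isStrictPartialOrder : IsStrictPartialOrder _≡_ _↝⁺_
  ↝⁺-isStrictPartialOrder = record
    { isEquivalence = isEquivalence
    ; irrefl        = λ { refl (_ , e , p) → acyclic e p }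
    ; trans         = λ (w , e , p) (_ , e′ , p′) → w , e , p ++ᵖ step e′ p′
    ; <-resp-≈      = resp₂ _↝⁺_
    }

  ancestors-wf : ∀ v → Acc _↝⁺_ v
  ancestors-wf = spo-wellFounded ↝⁺-isStrictPartialOrder

  descendants-wf : ∀ v → Acc (flip _↝⁺_) v
  descendants-wf = spo-noetherian ↝⁺-isStrictPartialOrder

  edge⁺ : ∀ {u v} → Edge G u v → u ↝⁺ v
  edge⁺ e = _ , e , here

  path? : ∀ u w → Dec (Path G u w)
  path? u w = go u (descendants-wf u)
    where
    go : ∀ u → Acc (flip _↝⁺_) u → Dec (Path G u w)
    go u (acc below) with u ≟ w | any? viaChild
      where
      viaChild : ∀ c → Dec (Edge G u c × Path G c w)
      viaChild c with Edge? u c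
      ... | yes e = map′ (e ,_) proj₂ (go c (below (edge⁺ e)))
      ... | no ¬e = no (¬e ∘ proj₁)
    ... | yes refl | _               = yes here
    ... | no _     | yes (_ , e , p) = yes (step e p)
    ... | no u≢w   | no none         = no λ { here → u≢w refl ; (step e p) → none (_ , e , p) }

  module Rooted (r : Fin n) (onlyRoot : ∀ v → indeg G v ≡ 0 → v ≡ r) where

    parent : ∀ {v} → v ≢ r → ∃ λ p → Edge G p v
    parent {v} v≢r with p , p∈ ← nonempty (n≢0⇒n>0 (v≢r ∘ onlyRoot v)) = p , ∈-tabulate⁻ p∈

    reach : ∀ v → Path G r v
    reach v = go v (ancestors-wf v)
      where
      go : ∀ v → Acc _↝⁺_ v → Path G r v
      go v (acc above) with v ≟ r
      ... | yes refl = here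
      ... | no v≢r with p , e ← parent v≢r = go p (above (edge⁺ e)) ▸ e

-- Chordless walks

-- Walks in a relation R are the elements of its reflexive-transitive closure.
module Walks {n} (R : Fin n → Fin n → Set) where

  verts later : ∀ {s t} → Star R s t → List (Fin n)
  verts {s} w = s ∷ later w
  later ε       = []
  later (_ ◅ w) = verts w

  end∈ : ∀ {s t} (w : Star R s t) → t ∈ₗ verts w
  end∈ ε       = here refl
  end∈ (_ ◅ w) = there (end∈ w)

  Chordless : ∀ {s t} → Star R s t → Set
  Chordless ε           = Unit
  Chordless {s} (_ ◅ w) = s ∉ₗ verts w × All (λ z → ¬ R s z) (later w) × Chordless w

  start∉later : ∀ {s t} (w : Star R s t) → Chordless w → s ∉ₗ later w
  start∉later (_ ◅ _) (s∉ , _) = s∉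

  -- Any walk can be shortened to a chordless one with the same ends: shorten
  -- the tail, then jump from the start to the last vertex of the shortened
  -- tail that equals or is related to the start.
  module Shortening (R? : ∀ a b → Dec (R a b)) (irrefl : ∀ {a} → ¬ R a a) where

    lastWith : (P : Fin n → Set) → (∀ a → Dec (P a)) → ∀ {m t} (w : Star R m t) → Chordless w
             → (∃ λ y → Σ (Star R y t) λ suf → P y × All (¬_ ∘ P) (later suf) × Chordless suf)
               ⊎ All (¬_ ∘ P) (verts w)
    lastWith P P? {m} ε _ with P? m
    ... | yes Pm = inj₁ (m , ε , Pm , [] , tt)
    ... | no ¬Pm = inj₂ (¬Pm ∷ [])
    lastWith P P? {m} (r ◅ w) cw@(_ , _ , cw′) with lastWith P P? w cw′
    ... | inj₁ found = inj₁ found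
    ... | inj₂ none with P? m
    ...   | yes Pm = inj₁ (m , r ◅ w , Pm , none , cw)
    ...   | no ¬Pm = inj₂ (¬Pm ∷ none)

    chordless : ∀ {s t} → Star R s t → Σ (Star R s t) Chordless
    chordless ε = ε , tt
    chordless {s} (r ◅ w) with chordless w
    ... | w′ , cw′ with lastWith (λ z → z ≡ s ⊎ R s z) (λ z → (z ≟ s) ⊎-dec R? s z) w′ cw′
    ... | inj₂ none                            = ⊥-elim (All.head none (inj₂ r))
    ... | inj₁ (_ , suf , inj₁ refl , _ , csuf) = suf , csuf
    ... | inj₁ (_ , suf , inj₂ sy , none , csuf) =
          sy ◅ suf , s∉ , All.map (λ ¬hit → ¬hit ∘ inj₂) none , csuf
      where
      s∉ : s ∉ₗ verts suf
      s∉ (here refl) = irrefl sy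
      s∉ (there s∈)  = All.lookup none s∈ (inj₁ refl)

  data _∋_⟶_ : ∀ {s t} → Star R s t → Fin n → Fin n → Set where
    first : ∀ {s m t} {r : R s m} {w : Star R m t} → (r ◅ w) ∋ s ⟶ m
    next  : ∀ {s m t a b} {r : R s m} {w : Star R m t} → w ∋ a ⟶ b → (r ◅ w) ∋ a ⟶ b

  step-R : ∀ {s t a b} {w : Star R s t} → w ∋ a ⟶ b → R a b
  step-R (first {r = r}) = r
  step-R (next st)       = step-R st

  step-∈ : ∀ {s t a b} {w : Star R s t} → w ∋ a ⟶ b → a ∈ₗ verts w × b ∈ₗ later w
  step-∈ first     = here refl , here refl
  step-∈ (next st) with a∈ , b∈ ← step-∈ st = there a∈ , there b∈

  stepInto : ∀ {s t x} (w : Star R s t) → x ∈ₗ verts w → x ≡ s ⊎ ∃ λ a → w ∋ a ⟶ x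
  stepInto _       (here x≡s) = inj₁ x≡s
  stepInto (_ ◅ w) (there x∈) with stepInto w x∈
  ... | inj₁ refl       = inj₂ (_ , first)
  ... | inj₂ (a , a⟶x) = inj₂ (a , next a⟶x)

  stepOutOf : ∀ {s t x} (w : Star R s t) → x ∈ₗ verts w → x ≡ t ⊎ ∃ λ b → w ∋ x ⟶ b
  stepOutOf ε       (here x≡s)  = inj₁ x≡s
  stepOutOf (_ ◅ w) (here refl) = inj₂ (_ , first)
  stepOutOf (_ ◅ w) (there x∈) with stepOutOf w x∈
  ... | inj₁ x≡t        = inj₁ x≡t
  ... | inj₂ (b , x⟶b) = inj₂ (b , next x⟶b)

  module Steps (sym-R : ∀ {a b} → R a b → R b a) (irrefl : ∀ {a} → ¬ R a a) where

    related⇒step : ∀ {s t a b} (w : Star R s t) → Chordless w → a ∈ₗ verts w → b ∈ₗ verts w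
                 → R a b → w ∋ a ⟶ b ⊎ w ∋ b ⟶ a
    related⇒step ε       _            (here refl) (here refl) r = ⊥-elim (irrefl r)
    related⇒step (_ ◅ _) _            (here refl) (here refl) r = ⊥-elim (irrefl r)
    related⇒step (_ ◅ _) _            (here refl) (there (here refl)) _ = inj₁ first
    related⇒step (_ ◅ _) (_ , far , _) (here refl) (there (there b∈)) r =
      ⊥-elim (All.lookup far b∈ r)
    related⇒step (_ ◅ _) _            (there (here refl)) (here refl) _ = inj₂ first
    related⇒step (_ ◅ _) (_ , far , _) (there (there a∈)) (here refl) r =
      ⊥-elim (All.lookup far a∈ (sym-R r))
    related⇒step (_ ◅ w) (_ , _ , cw) (there a∈) (there b∈) r with related⇒step w cw a∈ b∈ r
    ... | inj₁ a⟶b = inj₁ (next a⟶b)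
    ... | inj₂ b⟶a = inj₂ (next b⟶a)

    into-unique : ∀ {s t a b x} (w : Star R s t) → Chordless w → w ∋ a ⟶ x → w ∋ b ⟶ x → a ≡ b
    into-unique _       _            first      first      = refl
    into-unique (_ ◅ w) (_ , _ , cw) first      (next st)  = ⊥-elim (start∉later w cw (proj₂ (step-∈ st)))
    into-unique (_ ◅ w) (_ , _ , cw) (next st)  first      = ⊥-elim (start∉later w cw (proj₂ (step-∈ st)))
    into-unique (_ ◅ w) (_ , _ , cw) (next st) (next st′) = into-unique w cw st st′

    outOf-unique : ∀ {s t a b x} (w : Star R s t) → Chordless w → w ∋ x ⟶ a → w ∋ x ⟶ b → a ≡ b
    outOf-unique _       _            first      first      = refl
    outOf-unique (_ ◅ _) (s∉ , _)     first      (next st)  = ⊥-elim (s∉ (proj₁ (step-∈ st)))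
    outOf-unique (_ ◅ _) (s∉ , _)     (next st)  first      = ⊥-elim (s∉ (proj₁ (step-∈ st)))
    outOf-unique (_ ◅ w) (_ , _ , cw) (next st) (next st′) = outOf-unique w cw st st′

    no-return : ∀ {s t a x} (w : Star R s t) → Chordless w → w ∋ a ⟶ x → ¬ w ∋ x ⟶ a
    no-return _       _            (first {r = r}) first = irrefl r
    no-return (_ ◅ _) (s∉ , _)     first      (next st)  = s∉ (there (proj₂ (step-∈ st)))
    no-return (_ ◅ _) (s∉ , _)     (next st)  first      = s∉ (there (proj₂ (step-∈ st)))
    no-return (_ ◅ w) (_ , _ , cw) (next st) (next st′) = no-return w cw st st′

    start-not-entered : ∀ {s t a} (w : Star R s t) → Chordless w → ¬ w ∋ a ⟶ s
    start-not-entered w cw st = start∉later w cw (proj₂ (step-∈ st))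

    end-not-left : ∀ {s t b} (w : Star R s t) → Chordless w → ¬ w ∋ t ⟶ b
    end-not-left (_ ◅ w) (s∉ , _)     first     = s∉ (end∈ w)
    end-not-left (_ ◅ w) (_ , _ , cw) (next st) = end-not-left w cw st

-- Induced cycles through non-bridge edges

module InducedCycles {n} (G : Graph n) (noLoops : NoLoops G) where

  UAdj-sym : ∀ {a b} → UAdj G a b → UAdj G b a
  UAdj-sym {a} {b} ab = trans (Bool.∨-comm (G b a) (G a b)) ab

  edge⇒UAdj : ∀ {a b} → Edge G a b → UAdj G a b
  edge⇒UAdj {a} {b} ab = cong (λ g → g ∨ G b a) ab

  UAdj-irrefl : ∀ {a} → ¬ UAdj G a a
  UAdj-irrefl {a} aa = noLoops a (trans (sym (Bool.∨-idem (G a a))) aa)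

  ∈nbrsIn⁺ : ∀ {C x z} → UAdj G z x → z ∈ C → z ∈ nbrsIn G C x
  ∈nbrsIn⁺ zx z∈C = x∈p∩q⁺ (∈-tabulate⁺ zx , z∈C)

  ∈nbrsIn⁻ : ∀ {C x z} → z ∈ nbrsIn G C x → UAdj G z x × z ∈ C
  ∈nbrsIn⁻ {C} {x} z∈ with zx , z∈C ← x∈p∩q⁻ (tabulate λ z → uadj G z x) C z∈ =
    ∈-tabulate⁻ zx , z∈C

  _++ᵘ_ : ∀ {C a b c} → UPathIn G C a b → UPathIn G C b c → UPathIn G C a c
  here _       ++ᵘ q = q
  step a∈ ab p ++ᵘ q = step a∈ ab (p ++ᵘ q)

  reverseᵘ : ∀ {C a b} → UPathIn G C a b → UPathIn G C b a
  reverseᵘ (here a∈)       = here a∈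
  reverseᵘ (step a∈ ab p) = reverseᵘ p ++ᵘ step (start∈ p) (UAdj-sym ab) (here a∈)
    where
    start∈ : ∀ {C a b} → UPathIn G C a b → a ∈ C
    start∈ (here a∈)     = a∈
    start∈ (step a∈ _ _) = a∈

  Off : Fin n → Fin n → Fin n → Fin n → Set
  Off a b x y = UAdj G x y × ¬ (x ≡ a × y ≡ b) × ¬ (x ≡ b × y ≡ a)

  Off-sym : ∀ {a b x y} → Off a b x y → Off a b y x
  Off-sym (xy , ≢ab , ≢ba) = UAdj-sym xy , (λ (p , q) → ≢ba (q , p)) , (λ (p , q) → ≢ab (q , p))

  Off? : ∀ {a b} x y → Dec (Off a b x y)
  Off? {a} {b} x y =
    (uadj G x y Bool.≟ true) ×-dec ¬? ((x ≟ a) ×-dec (y ≟ b)) ×-dec ¬? ((x ≟ b) ×-dec (y ≟ a))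

  Off-swap : ∀ {a b x y} → Off a b x y → Off b a x y
  Off-swap (xy , ≢ab , ≢ba) = xy , ≢ba , ≢ab

  NonBridge : Fin n → Fin n → Set
  NonBridge u v = UAdj G u v × Star (Off u v) u v

  -- The vertex set of a chordless walk from u to v avoiding u – v induces a
  -- cycle: in it, each vertex x is adjacent exactly to its predecessor and its
  -- successor along the closed walk (u – v closing it up).
  module ChordlessCycle {u v} (uv : UAdj G u v) (w : Star (Off u v) u v) where

    open Walks (Off u v)

    module _ (cw : Chordless w) where
      open Steps Off-sym (UAdj-irrefl ∘ proj₁)

      C : Subset n
      C = listSet (verts w)

      u≢v : u ≢ v
      u≢v refl = UAdj-irrefl uv

      Pred Succ : Fin n → Fin n → Set
      Pred x z = (x ≡ u × z ≡ v) ⊎ w ∋ z ⟶ x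
      Succ x z = (x ≡ v × z ≡ u) ⊎ w ∋ x ⟶ z

      pred-exists : ∀ {x} → x ∈ₗ verts w → ∃ (Pred x)
      pred-exists x∈ with stepInto w x∈
      ... | inj₁ x≡u        = v , inj₁ (x≡u , refl)
      ... | inj₂ (a , a⟶x) = a , inj₂ a⟶x

      succ-exists : ∀ {x} → x ∈ₗ verts w → ∃ (Succ x)
      succ-exists x∈ with stepOutOf w x∈
      ... | inj₁ x≡v        = u , inj₁ (x≡v , refl)
      ... | inj₂ (b , x⟶b) = b , inj₂ x⟶b

      pred-unique : ∀ {x a b} → Pred x a → Pred x b → a ≡ b
      pred-unique (inj₁ (_ , refl))    (inj₁ (_ , refl)) = refl
      pred-unique (inj₁ (refl , _))    (inj₂ b⟶u)       = ⊥-elim (start-not-entered w cw b⟶u)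
      pred-unique (inj₂ a⟶u)          (inj₁ (refl , _)) = ⊥-elim (start-not-entered w cw a⟶u)
      pred-unique (inj₂ a⟶x)          (inj₂ b⟶x)       = into-unique w cw a⟶x b⟶x

      succ-unique : ∀ {x a b} → Succ x a → Succ x b → a ≡ b
      succ-unique (inj₁ (_ , refl))    (inj₁ (_ , refl)) = refl
      succ-unique (inj₁ (refl , _))    (inj₂ v⟶b)       = ⊥-elim (end-not-left w cw v⟶b)
      succ-unique (inj₂ v⟶a)          (inj₁ (refl , _)) = ⊥-elim (end-not-left w cw v⟶a)
      succ-unique (inj₂ x⟶a)          (inj₂ x⟶b)       = outOf-unique w cw x⟶a x⟶b

      no-direct-step : ¬ w ∋ u ⟶ v
      no-direct-step u⟶v = proj₁ (proj₂ (step-R u⟶v)) (refl , refl)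

      pred≢succ : ∀ {x z} → Pred x z → ¬ Succ x z
      pred≢succ (inj₁ (refl , _))    (inj₁ (u≡v , _))  = u≢v u≡v
      pred≢succ (inj₁ (refl , refl)) (inj₂ u⟶v)       = no-direct-step u⟶v
      pred≢succ (inj₂ u⟶v)          (inj₁ (refl , refl)) = no-direct-step u⟶v
      pred≢succ (inj₂ z⟶x)          (inj₂ x⟶z)       = no-return w cw z⟶x x⟶z

      pred-nbr : ∀ {x z} → Pred x z → z ∈ nbrsIn G C x
      pred-nbr (inj₁ (refl , refl)) = ∈nbrsIn⁺ (UAdj-sym uv) (∈listSet⁺ (verts w) (end∈ w))
      pred-nbr (inj₂ z⟶x) = ∈nbrsIn⁺ (proj₁ (step-R z⟶x)) (∈listSet⁺ (verts w) (proj₁ (step-∈ z⟶x)))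

      succ-nbr : ∀ {x z} → Succ x z → z ∈ nbrsIn G C x
      succ-nbr (inj₁ (refl , refl)) = ∈nbrsIn⁺ uv (∈listSet⁺ (verts w) (here refl))
      succ-nbr (inj₂ x⟶z) =
        ∈nbrsIn⁺ (UAdj-sym (proj₁ (step-R x⟶z))) (∈listSet⁺ (verts w) (there (proj₂ (step-∈ x⟶z))))

      nbr-pred-or-succ : ∀ {x z} → x ∈ₗ verts w → z ∈ nbrsIn G C x → Pred x z ⊎ Succ x z
      nbr-pred-or-succ {x} {z} x∈ z∈ with ∈nbrsIn⁻ z∈ | z ≟ u ×-dec x ≟ v | z ≟ v ×-dec x ≟ u
      ... | _ | yes (refl , refl) | _                 = inj₂ (inj₁ (refl , refl))
      ... | _ | no _              | yes (refl , refl) = inj₁ (inj₁ (refl , refl))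
      ... | zx , z∈C | no ≢uv     | no ≢vu
          with related⇒step w cw (∈listSet⁻ (verts w) z∈C) x∈ (zx , ≢uv , ≢vu)
      ...   | inj₁ z⟶x = inj₁ (inj₂ z⟶x)
      ...   | inj₂ x⟶z = inj₂ (inj₂ x⟶z)

      degree-at : ∀ {x} → x ∈ₗ verts w → ∣ nbrsIn G C x ∣ ≡ 2
      degree-at x∈ with a , pa ← pred-exists x∈ | b , sb ← succ-exists x∈ =
        ∣p∣≡2 (λ { refl → pred≢succ pa sb }) (pred-nbr pa) (succ-nbr sb) only
        where
        only : ∀ z → z ∈ nbrsIn G C _ → z ≡ a ⊎ z ≡ b
        only z z∈ with nbr-pred-or-succ x∈ z∈
        ... | inj₁ pz = inj₁ (pred-unique pz pa)
        ... | inj₂ sz = inj₂ (succ-unique sz sb)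

      -- u, its successor and v are three distinct vertices of C.
      size : 3 ≤ ∣ C ∣
      size with succ-exists (here refl)
      ... | _ , inj₁ (u≡v , _) = ⊥-elim (u≢v u≡v)
      ... | b , inj₂ u⟶b =
        3≤∣p∣ (λ { refl → UAdj-irrefl (proj₁ (step-R u⟶b)) }) u≢v
              (λ { refl → no-direct-step u⟶b })
              (∈listSet⁺ (verts w) (here refl))
              (∈listSet⁺ (verts w) (there (proj₂ (step-∈ u⟶b))))
              (∈listSet⁺ (verts w) (end∈ w))

      -- Every vertex of C is joined to u along the walk.
      connected : ∀ a b → a ∈ C → b ∈ C → UPathIn G C a b
      connected a b a∈ b∈ =
        reverseᵘ (fromStart w id (∈listSet⁻ _ a∈)) ++ᵘ fromStart w id (∈listSet⁻ _ b∈)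
        where
        fromStart : ∀ {s t x} (w′ : Star (Off u v) s t)
                  → (∀ {z} → z ∈ₗ verts w′ → z ∈ₗ verts w) → x ∈ₗ verts w′ → UPathIn G C s x
        fromStart _        sub (here refl) = here (∈listSet⁺ (verts w) (sub (here refl)))
        fromStart (r ◅ w′) sub (there x∈)  =
          step (∈listSet⁺ (verts w) (sub (here refl))) (proj₁ r) (fromStart w′ (sub ∘ there) x∈)

      isCycle : IsCycle G C
      isCycle = size , (λ x x∈C → degree-at (∈listSet⁻ (verts w) x∈C)) , connected

  cycleThrough : ∀ {u v} → NonBridge u v → ∃ λ C → IsCycle G C × u ∈ C × v ∈ C
  cycleThrough {u} {v} (uv , w₀)
    with w , cw ← Walks.Shortening.chordless (Off u v) Off? (UAdj-irrefl ∘ proj₁) w₀ =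
    C cw , isCycle cw , ∈listSet⁺ (verts w) (here refl) , ∈listSet⁺ (verts w) (end∈ w)
    where
    open Walks (Off u v) using (verts; end∈)
    open ChordlessCycle uv w using (C; isCycle)

  -- In a level-1 graph an interior vertex v has at most two neighbours joined
  -- to it by non-bridge edges: their cycles through v coincide, and v has
  -- only two neighbours on that cycle.
  at-most-two-nonbridges : IsLevel1 G → ∀ {v a b c} → Interior G v
                         → NonBridge a v → NonBridge b v → NonBridge c v
                         → a ≢ b → a ≢ c → b ≢ c → ⊥
  at-most-two-nonbridges level1 {v} {a} {b} {c} iv av bv cv a≢b a≢c b≢c
    with C , cyc , a∈C , v∈C ← cycleThrough av
       | C′ , cyc′ , b∈C′ , v∈C′ ← cycleThrough bv
       | C″ , cyc″ , c∈C″ , v∈C″ ← cycleThrough cv =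
    ℕₚ.<-irrefl refl (subst (3 ≤_) (proj₁ (proj₂ cyc) v v∈C) three-nbrs)
    where
    same : ∀ {D} → IsCycle G D → v ∈ D → D ≡ C
    same cycD v∈D = level1 v iv _ C cycD cyc v∈D v∈C

    three-nbrs : 3 ≤ ∣ nbrsIn G C v ∣
    three-nbrs = 3≤∣p∣ a≢b a≢c b≢c
      (∈nbrsIn⁺ (proj₁ av) a∈C)
      (∈nbrsIn⁺ (proj₁ bv) (subst (b ∈_) (same cyc′ v∈C′) b∈C′))
      (∈nbrsIn⁺ (proj₁ cv) (subst (c ∈_) (same cyc″ v∈C″) c∈C″))

-- Rooted acyclic level-1 graphs

module Level1Network {n} (G : Graph n) (acyclic : Acyclic G) (level1 : IsLevel1 G)
                     (r : Fin n) (onlyRoot : ∀ v → indeg G v ≡ 0 → v ≡ r) where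

  open AcyclicGraph G acyclic
  open Rooted r onlyRoot
  open InducedCycles G noLoops

  -- An edge x → y other than a → b avoids a – b: the reverse edge b → a would
  -- close a 2-cycle with a → b.
  edge-off : ∀ {a b x y} → Edge G a b → Edge G x y → ¬ (x ≡ a × y ≡ b) → Off a b x y
  edge-off ab xy ≢ab = edge⇒UAdj xy , ≢ab , λ { (refl , refl) → acyclic ab (step xy here) }

  path-avoiding : ∀ {a b s t} → Edge G a b → ¬ (Path G s a × Path G b t) → Path G s t
                → Star (Off a b) s t
  path-avoiding ab avoid here       = ε
  path-avoiding ab avoid (step e p) =
    edge-off ab e (λ { (refl , refl) → avoid (here , p) })
    ◅ path-avoiding ab (λ (sa , bt) → avoid (step e sa , bt)) p

  path-avoiding⁻ : ∀ {a b s t} → Edge G a b → ¬ (Path G s a × Path G b t) → Path G s t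
                 → Star (Off a b) t s
  path-avoiding⁻ ab avoid p = reverse Off-sym (path-avoiding ab avoid p)

  -- Two children of v with a common descendant give non-bridge edges at v:
  -- a ⇝ t ⇜ b ← v returns from a to v.
  sibling-nonbridge : ∀ {v a b t} → Edge G v a → Edge G v b → a ≢ b
                    → Path G a t → Path G b t → NonBridge a v
  sibling-nonbridge va vb a≢b a⇝t b⇝t =
    UAdj-sym (edge⇒UAdj va) ,
    mapStar Off-swap
      (path-avoiding va (acyclic va ∘ proj₁) a⇝t
       ◅◅ path-avoiding⁻ va (acyclic vb ∘ proj₁) b⇝t
       ◅◅ return (Off-sym (edge-off va vb (λ (_ , b≡a) → a≢b (sym b≡a)))))

  -- Let v₁ and v₂ be incomparable.  A child c of v₁ with a descendant t of
  -- v₂ gives a non-bridge edge: c ⇝ t ⇜ v₂ ⇜ r ⇝ v₁.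
  child-nonbridge : ∀ {v₁ v₂ c t} → ¬ Path G v₁ v₂ → ¬ Path G v₂ v₁
                  → Edge G v₁ c → Path G c t → Path G v₂ t → NonBridge c v₁
  child-nonbridge {v₁} {v₂} v₁⇏v₂ v₂⇏v₁ v₁c c⇝t v₂⇝t =
    UAdj-sym (edge⇒UAdj v₁c) ,
    mapStar Off-swap
      (path-avoiding v₁c (acyclic v₁c ∘ proj₁) c⇝t
       ◅◅ path-avoiding⁻ v₁c (v₂⇏v₁ ∘ proj₁) v₂⇝t
       ◅◅ path-avoiding⁻ v₁c (λ (_ , c⇝v₂) → v₁⇏v₂ (step v₁c c⇝v₂)) (reach v₂)
       ◅◅ path-avoiding v₁c (acyclic v₁c ∘ proj₂) (reach v₁))

  -- Likewise, if v₁ and v₂ have a common descendant t, a parent p of v₁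
  -- gives a non-bridge edge: p ⇜ r ⇝ v₂ ⇝ t ⇜ v₁.
  parent-nonbridge : ∀ {v₁ v₂ p t} → ¬ Path G v₁ v₂ → ¬ Path G v₂ v₁
                   → Edge G p v₁ → Path G v₁ t → Path G v₂ t → NonBridge p v₁
  parent-nonbridge {v₁} {v₂} {p} v₁⇏v₂ v₂⇏v₁ pv₁ v₁⇝t v₂⇝t =
    edge⇒UAdj pv₁ ,
    path-avoiding⁻ pv₁ (acyclic pv₁ ∘ proj₂) (reach p)
    ◅◅ path-avoiding pv₁ (v₁⇏v₂ ∘ proj₂) (reach v₂)
    ◅◅ path-avoiding pv₁ (λ (v₂⇝p , _) → v₂⇏v₁ (v₂⇝p ▸ pv₁)) v₂⇝t
    ◅◅ path-avoiding⁻ pv₁ (acyclic pv₁ ∘ proj₁) v₁⇝t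

  module LowestCommonAncestor (Y : Subset n) (Y-leaves : ∀ y → y ∈ Y → IsLeaf G y)
                              (2≤∣Y∣ : 2 ≤ ∣ Y ∣) where

    some-leaf : ∃ λ x → x ∈ Y
    some-leaf = nonempty (≤-trans (s≤s z≤n) 2≤∣Y∣)

    _⊆F?_ : ∀ (Z : Subset n) v → Dec (_⊆F_ G Z v)
    Z ⊆F? v = map′ (λ h w → h w) (λ h w → h w) (all? λ w → (w ∈? Z) →-dec (leaf? w ×-dec path? v w))

    -- A leaf reaches only itself, so a vertex reaching all of Y is interior.
    ⊆F⇒interior : ∀ {v} → _⊆F_ G Y v → Interior G v
    ⊆F⇒interior Y⊆v v-leaf =
      ℕₚ.<-irrefl refl (≤-trans 2≤∣Y∣ (∣p∣≤1 _ λ y y∈Y → leaf-path v-leaf (proj₂ (Y⊆v y y∈Y))))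

    descend : ∀ v → Acc (flip _↝⁺_) v → _⊆F_ G Y v → ∃ (IsVY G Y)
    descend v (acc below) Y⊆v with any? (λ c → Edge? v c ×-dec (Y ⊆F? c))
    ... | yes (c , vc , Y⊆c) = descend c (below (edge⁺ vc)) Y⊆c
    ... | no none            = v , ⊆F⇒interior Y⊆v , Y⊆v , λ c vc Y⊆c → none (c , vc , Y⊆c)

    vY-exists : ∃ (IsVY G Y)
    vY-exists = descend r (descendants-wf r) (λ y y∈Y → Y-leaves y y∈Y , reach y)

    child-toward : ∀ {v y} → IsVY G Y v → y ∈ Y → ∃ λ c → Edge G v c × Path G c y
    child-toward (iv , Y⊆v , _) y∈Y =
      firstEdge (proj₂ (Y⊆v _ y∈Y)) λ { refl → iv (Y-leaves _ y∈Y) }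

    child-misses : ∀ {v c} → IsVY G Y v → Edge G v c → ∃ λ y → y ∈ Y × ¬ Path G c y
    child-misses {c = c} (_ , _ , lowest) vc with any? (λ y → (y ∈? Y) ×-dec ¬? (path? c y))
    ... | yes (y , y∈Y , c⇏y) = y , y∈Y , c⇏y
    ... | no  none             = ⊥-elim (lowest c vc λ y y∈Y → Y-leaves y y∈Y , reaches y y∈Y)
      where
      reaches : ∀ y → y ∈ Y → Path G c y
      reaches y y∈Y with path? c y
      ... | yes c⇝y = c⇝y
      ... | no  c⇏y = ⊥-elim (none (y , y∈Y , c⇏y))

    vY-not-above : ∀ {a b} → IsVY G Y a → _⊆F_ G Y b → a ≢ b → ¬ Path G a b
    vY-not-above _                 _    a≢b here        = a≢b refl
    vY-not-above (_ , _ , lowest) Y⊆b _   (step ac c⇝b) =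
      lowest _ ac λ y y∈Y → proj₁ (Y⊆b y y∈Y) , c⇝b ++ᵖ proj₂ (Y⊆b y y∈Y)

    -- v_Y is comparable with every vertex v₂ reaching Y: otherwise v_Y has
    -- three non-bridge edges, to a child c towards some x ∈ Y, to a child c′
    -- towards some y ∈ Y missed by c, and to a parent p.
    vY-comparable : ∀ {v₁ v₂} → IsVY G Y v₁ → _⊆F_ G Y v₂
                  → ¬ Path G v₁ v₂ → ¬ Path G v₂ v₁ → ⊥
    vY-comparable {v₁} {v₂} h₁ Y⊆v₂ v₁⇏v₂ v₂⇏v₁ with some-leaf
    ... | x , x∈Y with child-toward h₁ x∈Y
    ... | c , v₁c , c⇝x with child-misses h₁ v₁c
    ... | y , y∈Y , c⇏y with child-toward h₁ y∈Y
    ... | c′ , v₁c′ , c′⇝y with parent {v₁} (λ { refl → v₁⇏v₂ (reach v₂) })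
    ... | p , pv₁ =
      at-most-two-nonbridges level1 (proj₁ h₁)
        (child-nonbridge v₁⇏v₂ v₂⇏v₁ v₁c  c⇝x  (below₂ x∈Y))
        (child-nonbridge v₁⇏v₂ v₂⇏v₁ v₁c′ c′⇝y (below₂ y∈Y))
        (parent-nonbridge v₁⇏v₂ v₂⇏v₁ pv₁ (proj₂ (proj₁ (proj₂ h₁) x x∈Y)) (below₂ x∈Y))
        (λ { refl → c⇏y c′⇝y })
        (λ { refl → acyclic v₁c (step pv₁ here) })
        (λ { refl → acyclic v₁c′ (step pv₁ here) })
      where
      below₂ : ∀ {y} → y ∈ Y → Path G v₂ y
      below₂ y∈Y = proj₂ (Y⊆v₂ _ y∈Y)

    vY-unique : ∀ {v₁ v₂} → IsVY G Y v₁ → IsVY G Y v₂ → v₁ ≡ v₂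
    vY-unique {v₁} {v₂} h₁@(_ , Y⊆v₁ , _) h₂@(_ , Y⊆v₂ , _) with v₁ ≟ v₂
    ... | yes v₁≡v₂ = v₁≡v₂
    ... | no  v₁≢v₂ = ⊥-elim (vY-comparable h₁ Y⊆v₂
                               (vY-not-above h₁ Y⊆v₂ v₁≢v₂) (vY-not-above h₂ Y⊆v₁ (v₁≢v₂ ∘ sym)))

    ChildReachesBoth : Fin n → Fin n → Fin n → Set
    ChildReachesBoth v x y = ∃ λ c → Edge G v c × Path G c x × Path G c y

    pair-vY : ∀ {v x y} → IsVY G Y v → x ∈ Y → y ∈ Y → ¬ ChildReachesBoth v x y
            → IsVY G (⁅ x ⁆ ∪ ⁅ y ⁆) v
    pair-vY {v} {x} {y} (iv , Y⊆v , _) x∈Y y∈Y none =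
      iv , xy⊆v , λ c vc xy⊆c → none (c , vc , proj₂ (xy⊆c x x∈xy) , proj₂ (xy⊆c y y∈xy))
      where
      x∈xy = x∈p∪q⁺ (inj₁ (x∈⁅x⁆ x))
      y∈xy = x∈p∪q⁺ (inj₂ (x∈⁅x⁆ y))
      xy⊆v : _⊆F_ G (⁅ x ⁆ ∪ ⁅ y ⁆) v
      xy⊆v z z∈xy with x∈p∪q⁻ ⁅ x ⁆ ⁅ y ⁆ z∈xy
      ... | inj₁ z∈x rewrite x∈⁅y⁆⇒x≡y x z∈x = Y⊆v x x∈Y
      ... | inj₂ z∈y rewrite x∈⁅y⁆⇒x≡y y z∈y = Y⊆v y y∈Y

    -- Take a child
    -- c₁ towards x and a leaf y missed by c₁; if a child c₂ reaches x and y,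
    -- take a leaf z missed by c₂; if a child c₃ reaches y and z, then c₁, c₂
    -- and c₃ are distinct children pairwise sharing descendants, i.e. three
    -- non-bridge edges at v_Y.
    separated-pair : ∀ {v} → IsVY G Y v
                   → ∃₂ λ x y → x ∈ Y × y ∈ Y × x ≢ y × ¬ ChildReachesBoth v x y
    separated-pair {v} h with some-leaf
    ... | x , x∈Y with child-toward h x∈Y
    ... | c₁ , vc₁ , c₁⇝x with child-misses h vc₁
    ... | y , y∈Y , c₁⇏y with any? (λ c → Edge? v c ×-dec path? c x ×-dec path? c y)
    ... | no none = x , y , x∈Y , y∈Y , (λ { refl → c₁⇏y c₁⇝x }) , none
    ... | yes (c₂ , vc₂ , c₂⇝x , c₂⇝y) with child-misses h vc₂
    ... | z , z∈Y , c₂⇏z with any? (λ c → Edge? v c ×-dec path? c y ×-dec path? c z)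
    ... | no none = y , z , y∈Y , z∈Y , (λ { refl → c₂⇏z c₂⇝y }) , none
    ... | yes (c₃ , vc₃ , c₃⇝y , c₃⇝z) = ⊥-elim
      (at-most-two-nonbridges level1 (proj₁ h)
        (sibling-nonbridge vc₁ vc₂ c₁≢c₂ c₁⇝x c₂⇝x)
        (sibling-nonbridge vc₂ vc₁ (c₁≢c₂ ∘ sym) c₂⇝x c₁⇝x)
        (sibling-nonbridge vc₃ vc₂ (c₂≢c₃ ∘ sym) c₃⇝y c₂⇝y)
        c₁≢c₂ c₁≢c₃ c₂≢c₃)
      where
      c₁≢c₂ : c₁ ≢ c₂
      c₁≢c₂ refl = c₁⇏y c₂⇝y
      c₁≢c₃ : c₁ ≢ c₃
      c₁≢c₃ refl = c₁⇏y c₃⇝y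
      c₂≢c₃ : c₂ ≢ c₃
      c₂≢c₃ refl = c₂⇏z c₃⇝z

lemma1 : ∀ {n : ℕ} (G : Graph n) → IsLevel1Network G
       → (Y : Subset n) → (∀ w → w ∈ Y → IsLeaf G w) → 2 ≤ ∣ Y ∣
       → Σ (Fin n) λ v →
           IsVY G Y v
         × (∀ v′ → IsVY G Y v′ → v′ ≡ v)
         × (Σ (Fin n) λ x → Σ (Fin n) λ y →
              x ∈ Y × y ∈ Y × ¬ x ≡ y × IsVY G (⁅ x ⁆ ∪ ⁅ y ⁆) v)
lemma1 G ((_ , acyclic , (r , _ , onlyRoot) , _) , level1) Y Y-leaves 2≤∣Y∣ =
  let open Level1Network G acyclic level1 r onlyRoot
      open LowestCommonAncestor Y Y-leaves 2≤∣Y∣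
      (v , v-is-vY) = vY-exists
      (x , y , x∈Y , y∈Y , x≢y , separated) = separated-pair v-is-vY
  in  v , v-is-vY , (λ v′ h′ → vY-unique h′ v-is-vY)
      , x , y , x∈Y , y∈Y , x≢y , pair-vY v-is-vY x∈Y y∈Y separated
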